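{- The calculus $\mathsf{LNS}_\mathsf{KB}$ is sound and complete for modal logic $\mathsf{KB}$: for every mono-modal formula $\varphi$, the sequent $\epsilon\Rightarrow\varphi$ is derivable in $\mathsf{LNS}_\mathsf{KB}$ if and only if $\varphi\in\mathsf{KB}$.
   Context: Mono-modal formulas: $A ::= p \mid \bot \mid A\to A \mid \Box A$ ($p$ from a set of atoms), with $\neg,\wedge,\vee,\Diamond$ defined classically ($\Diamond A:=\neg\Box\neg A$). $\mathsf{KB}$ is the set of formulas true at every world of every Kripke model $\langle W,R,V\rangle$ whose relation $R$ is symmetric, where $w\Vdash\Box A$ iff $v\Vdash A$ for all $v$ with $wRv$. A component is $\Gamma\Rightarrow\Delta$ with $\Gamma,\Delta$ finite multisets of formulas; $\epsilon$ denotes an empty multiset. Linear nested sequents for $\mathsf{KB}$: $S ::= \Gamma\Rightarrow\Delta \mid \Gamma\Rightarrow\Delta\nearrow S$. $\mathcal{G}$ denotes a possibly empty prefix, and $\mathcal{G}\nearrow X$ is $X$ if $\mathcal{G}$ is empty. Derivations are finite trees of rule instances whose leaves are instances of $(id)$ or $\bot_L$. Rules of $\mathsf{LNS}_\mathsf{KB}$ (premisses ⟹ conclusion): $(id)$: ⟹ $\mathcal{G}\nearrow\Gamma,p\Rightarrow p,\Delta$ ($p$ atomic). $\bot_L$: ⟹ $\mathcal{G}\nearrow\Gamma,\bot\Rightarrow\Delta$. $\mathsf{EW}$: $\mathcal{G}$ ⟹ $\mathcal{G}\nearrow\Gamma\Rightarrow\Delta$ ($\mathcal{G}$ nonempty).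 $\to_R$: $\mathcal{G}\nearrow\Gamma,A\Rightarrow\Delta,A\to B,B$ ⟹ $\mathcal{G}\nearrow\Gamma\Rightarrow\Delta,A\to B$. $\to_L$: $\mathcal{G}\nearrow\Gamma,A\to B,B\Rightarrow\Delta$ and $\mathcal{G}\nearrow\Gamma,A\to B\Rightarrow\Delta,A$ ⟹ $\mathcal{G}\nearrow\Gamma,A\to B\Rightarrow\Delta$. $\Box_R$: $\mathcal{G}\nearrow\Gamma\Rightarrow\Delta,\Box A\nearrow\epsilon\Rightarrow A$ ⟹ $\mathcal{G}\nearrow\Gamma\Rightarrow\Delta,\Box A$. $\Box_L^1$: $\mathcal{G}\nearrow\Gamma,\Box A\Rightarrow\Delta\nearrow\Sigma,A\Rightarrow\Pi$ ⟹ $\mathcal{G}\nearrow\Gamma,\Box A\Rightarrow\Delta\nearrow\Sigma\Rightarrow\Pi$. $\Box_L^2$: $\mathcal{G}\nearrow\Gamma,A\Rightarrow\Delta$ ⟹ $\mathcal{G}\nearrow\Gamma\Rightarrow\Delta\nearrow\Sigma,\Box A\Rightarrow\Pi$. -}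

module Defs where

open import Data.Nat using (ℕ)
open import Data.Bool using (Bool; T)
open import Data.List using (List; []; _∷_)
open import Data.Empty using (⊥)
open import Data.List.Relation.Binary.Permutation.Propositional using (_↭_)

infixr 6 _⇛_
data Fml : Set where
  atom : ℕ → Fml
  ⊥ᶠ   : Fml
  _⇛_  : Fml → Fml → Fml
  □_   : Fml → Fml

record SymModel : Set₁ where
  field
    W   : Set
    R   : W → W → Set
    V   : W → ℕ → Bool
    sym : ∀ {w v} → R w v → R v w

open SymModel public

_,_⊩_ : (M : SymModel) → W M → Fml → Set
M , w ⊩ atom p  = T (V M w p)
M , w ⊩ ⊥ᶠ      = ⊥
M , w ⊩ (A ⇛ B) = M , w ⊩ A → M , w ⊩ B
M , w ⊩ (□ A)   = ∀ v → R M w v → M , v ⊩ A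

KB : Fml → Set₁
KB φ = (M : SymModel) (w : W M) → M , w ⊩ φ

-- Linear nested sequents. Multisets are lists taken up to permutation
-- (rule Perm below).

infix 4 _⇒_
data Comp : Set where
  _⇒_ : List Fml → List Fml → Comp

infixr 3 _∷↗_
data LNS : Set where
  [_]  : Comp → LNS
  _∷↗_ : Comp → LNS → LNS

infixr 2 _↗_
_↗_ : List Comp → LNS → LNS
[]      ↗ X = X
(c ∷ G) ↗ X = c ∷↗ (G ↗ X)

toList : LNS → List Comp
toList [ c ]      = c ∷ []
toList (c ∷↗ S)   = c ∷ toList S

data _≈C_ : Comp → Comp → Set where
  perm : ∀ {Γ Γ' Δ Δ'} → Γ ↭ Γ' → Δ ↭ Δ' → (Γ ⇒ Δ) ≈C (Γ' ⇒ Δ')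

data _≈_ : LNS → LNS → Set where
  one  : ∀ {c c'} → c ≈C c' → [ c ] ≈ [ c' ]
  cons : ∀ {c c' S S'} → c ≈C c' → S ≈ S' → (c ∷↗ S) ≈ (c' ∷↗ S')

data ⊢_ : LNS → Set where
  Perm : ∀ {S S'} → ⊢ S → S ≈ S' → ⊢ S'
  id   : ∀ {G Γ Δ p} → ⊢ (G ↗ [ atom p ∷ Γ ⇒ atom p ∷ Δ ])
  ⊥L   : ∀ {G Γ Δ} → ⊢ (G ↗ [ ⊥ᶠ ∷ Γ ⇒ Δ ])
  EW   : ∀ {S Γ Δ} → ⊢ S → ⊢ (toList S ↗ [ Γ ⇒ Δ ])
  ⇛R   : ∀ {G Γ Δ A B} →
         ⊢ (G ↗ [ A ∷ Γ ⇒ (A ⇛ B) ∷ B ∷ Δ ]) →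
         ⊢ (G ↗ [ Γ ⇒ (A ⇛ B) ∷ Δ ])
  ⇛L   : ∀ {G Γ Δ A B} →
         ⊢ (G ↗ [ (A ⇛ B) ∷ B ∷ Γ ⇒ Δ ]) →
         ⊢ (G ↗ [ (A ⇛ B) ∷ Γ ⇒ A ∷ Δ ]) →
         ⊢ (G ↗ [ (A ⇛ B) ∷ Γ ⇒ Δ ])
  □R   : ∀ {G Γ Δ A} →
         ⊢ (G ↗ (Γ ⇒ □ A ∷ Δ) ∷↗ [ [] ⇒ A ∷ [] ]) →
         ⊢ (G ↗ [ Γ ⇒ □ A ∷ Δ ])
  □L¹  : ∀ {G Γ Δ Σ Π A} →
         ⊢ (G ↗ (□ A ∷ Γ ⇒ Δ) ∷↗ [ A ∷ Σ ⇒ Π ]) →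
         ⊢ (G ↗ (□ A ∷ Γ ⇒ Δ) ∷↗ [ Σ ⇒ Π ])
  □L²  : ∀ {G Γ Δ Σ Π A} →
         ⊢ (G ↗ [ A ∷ Γ ⇒ Δ ]) →
         ⊢ (G ↗ (Γ ⇒ Δ) ∷↗ [ □ A ∷ Σ ⇒ Π ])

module Submission where

-- Soundness: forcing is ¬¬-stable, so each rule can be read backwards, turning a path of worlds
-- falsifying its conclusion into one falsifying a premiss; only □L² uses symmetry.
--
-- Completeness is by terminating proof search on the last component of a linear nested sequent.
-- The propositional rules saturate it; when □A is on its left but A is missing on the left of the
-- parent, □L² adds A there and the search resumes at the parent; otherwise every □B on the right
-- opens a child unbox Γ ⇒ B. Either everything closes into a derivation, or we obtain a tree in
-- which each node and its children see each other through their boxes, a symmetric countermodel.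
-- All formulas stay subformulas of φ and the nesting depth is bounded by the modal depth of φ,
-- which makes the search well founded.

open import Defs
open import Data.Empty using (⊥-elim)
open import Data.List using (List; []; _∷_; _++_; length; reverse)
open import Data.List.Properties using (length-++; ++-assoc; ++-identityʳ; unfold-reverse)
open import Data.List.Membership.Propositional using (_∈_; _∉_; find; lose)
open import Data.List.Membership.Propositional.Properties using (∈-++⁺ˡ; ∈-++⁺ʳ; ∈-++⁻; ∈-∃++)
open import Data.List.Relation.Binary.Permutation.Propositional using (_↭_; ↭-refl; ↭-sym; ↭-trans; prep; swap)
open import Data.List.Relation.Binary.Permutation.Propositional.Properties using (All-resp-↭; shift)
open import Data.List.Relation.Binary.Subset.Propositional using (_⊆_)
open import Data.List.Relation.Unary.All as All using (All; []; _∷_)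
open import Data.List.Relation.Unary.Any using (Any; here; there; any?)
open import Data.Nat using (ℕ; zero; suc; _+_; _≤_; _<_; _⊔_; z≤n; s≤s)
open import Data.Nat.Induction using (<-wellFounded)
open import Data.Nat.Properties
  using (≤-refl; ≤-trans; n≤1+n; m≤m⊔n; m≤n⊔m; m≤m+n; +-comm; +-suc; +-mono-≤; +-mono-<-≤; +-mono-≤-<)
  renaming (_≟_ to _≟ℕ_)
open import Data.Product using (Σ-syntax; ∃-syntax; _×_; _,_; proj₁; proj₂)
open import Data.Sum using (_⊎_; inj₁; inj₂) renaming (swap to ⊎-swap; map to ⊎-map)
open import Data.Unit using (⊤; tt)
open import Data.Vec using (Vec; []; _∷_)
open import Data.Vec.Relation.Binary.Lex.Strict using (Lex-<; this; next) renaming (<-wellFounded to Lex-wellFounded)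
open import Function using (_∘_; _⇔_; mk⇔)
open import Induction.WellFounded using (Acc; acc; WellFounded)
open import Relation.Binary.Definitions using (DecidableEquality)
open import Relation.Binary.PropositionalEquality as ≡ using (_≡_; _≢_; refl; cong; cong₂; subst; module ≡-Reasoning)
open import Relation.Nullary using (¬_; yes; no; ¬?)
open import Relation.Nullary.Decidable using (map′; _×-dec_; _⊎-dec_; isYes; toWitness; fromWitness; decidable-stable; T?)
open import Relation.Unary using (Decidable)

atom-injective : ∀ {p q} → atom p ≡ atom q → p ≡ q
atom-injective refl = refl

⇛-injective : ∀ {A B C D} → (A ⇛ B) ≡ (C ⇛ D) → A ≡ C × B ≡ D
⇛-injective refl = refl , refl

□-injective : ∀ {A B} → □ A ≡ □ B → A ≡ B
□-injective refl = refl

infix 4 _≟_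
_≟_ : DecidableEquality Fml
atom p  ≟ atom q  = map′ (cong atom) atom-injective (p ≟ℕ q)
⊥ᶠ      ≟ ⊥ᶠ      = yes refl
(A ⇛ B) ≟ (C ⇛ D) = map′ (λ (A≡C , B≡D) → cong₂ _⇛_ A≡C B≡D) ⇛-injective (A ≟ C ×-dec B ≟ D)
□ A     ≟ □ B     = map′ (cong □_) □-injective (A ≟ B)
atom _  ≟ ⊥ᶠ      = no λ ()
atom _  ≟ (_ ⇛ _) = no λ ()
atom _  ≟ □ _     = no λ ()
⊥ᶠ      ≟ atom _  = no λ ()
⊥ᶠ      ≟ (_ ⇛ _) = no λ ()
⊥ᶠ      ≟ □ _     = no λ ()
(_ ⇛ _) ≟ atom _  = no λ ()
(_ ⇛ _) ≟ ⊥ᶠ      = no λ ()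
(_ ⇛ _) ≟ □ _     = no λ ()
□ _     ≟ atom _  = no λ ()
□ _     ≟ ⊥ᶠ      = no λ ()
□ _     ≟ (_ ⇛ _) = no λ ()

open import Data.List.Membership.DecPropositional _≟_ using (_∈?_)

modalDepth : Fml → ℕ
modalDepth (atom _) = 0
modalDepth ⊥ᶠ       = 0
modalDepth (A ⇛ B)  = modalDepth A ⊔ modalDepth B
modalDepth (□ A)    = suc (modalDepth A)

subformulas : Fml → List Fml
subformulas (atom p) = atom p ∷ []
subformulas ⊥ᶠ       = ⊥ᶠ ∷ []
subformulas (A ⇛ B)  = (A ⇛ B) ∷ subformulas A ++ subformulas B
subformulas (□ A)    = □ A ∷ subformulas A

infix 4 _≼_
_≼_ : Fml → Fml → Set
A ≼ B = A ∈ subformulas B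

≼-refl : ∀ A → A ≼ A
≼-refl (atom _) = here refl
≼-refl ⊥ᶠ       = here refl
≼-refl (_ ⇛ _)  = here refl
≼-refl (□ _)    = here refl

≼-trans : ∀ {A B C} → A ≼ B → B ≼ C → A ≼ C
≼-trans {C = atom _} A≼B (here refl) = A≼B
≼-trans {C = ⊥ᶠ}     A≼B (here refl) = A≼B
≼-trans {C = _ ⇛ _}  A≼B (here refl) = A≼B
≼-trans {C = □ _}    A≼B (here refl) = A≼B
≼-trans {C = C ⇛ _}  A≼B (there B≼) with ∈-++⁻ (subformulas C) B≼
... | inj₁ B≼C = there (∈-++⁺ˡ (≼-trans A≼B B≼C))
... | inj₂ B≼D = there (∈-++⁺ʳ (subformulas C) (≼-trans A≼B B≼D))
≼-trans {C = □ _}    A≼B (there B≼C) = there (≼-trans A≼B B≼C)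

unbox : List Fml → List Fml
unbox []             = []
unbox (atom _ ∷ Γ)  = unbox Γ
unbox (⊥ᶠ ∷ Γ)      = unbox Γ
unbox ((_ ⇛ _) ∷ Γ) = unbox Γ
unbox (□ A ∷ Γ)     = A ∷ unbox Γ

∈-unbox⁺ : ∀ {A} Γ → □ A ∈ Γ → A ∈ unbox Γ
∈-unbox⁺ (_ ∷ _)        (here refl) = here refl
∈-unbox⁺ (atom _ ∷ Γ)  (there m)   = ∈-unbox⁺ Γ m
∈-unbox⁺ (⊥ᶠ ∷ Γ)      (there m)   = ∈-unbox⁺ Γ m
∈-unbox⁺ ((_ ⇛ _) ∷ Γ) (there m)   = ∈-unbox⁺ Γ m
∈-unbox⁺ (□ _ ∷ Γ)     (there m)   = there (∈-unbox⁺ Γ m)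

∈-unbox⁻ : ∀ {A} Γ → A ∈ unbox Γ → □ A ∈ Γ
∈-unbox⁻ (atom _ ∷ Γ)  m           = there (∈-unbox⁻ Γ m)
∈-unbox⁻ (⊥ᶠ ∷ Γ)      m           = there (∈-unbox⁻ Γ m)
∈-unbox⁻ ((_ ⇛ _) ∷ Γ) m           = there (∈-unbox⁻ Γ m)
∈-unbox⁻ (□ _ ∷ Γ)     (here refl) = here refl
∈-unbox⁻ (□ _ ∷ Γ)     (there m)   = there (∈-unbox⁻ Γ m)

-- Soundness

module Soundness (M : SymModel) where

  ⊩-stable : ∀ F w → ¬ ¬ (M , w ⊩ F) → M , w ⊩ F
  ⊩-stable (atom p) w = decidable-stable (T? (V M w p))
  ⊩-stable ⊥ᶠ       w ¬¬⊥ = ¬¬⊥ λ b → b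
  ⊩-stable (A ⇛ B)  w ¬¬f a = ⊩-stable B w λ ¬b → ¬¬f λ f → ¬b (f a)
  ⊩-stable (□ A)    w ¬¬f v wRv = ⊩-stable A v λ ¬a → ¬¬f λ f → ¬a (f v wRv)

  FailsAt : W M → Comp → Set
  FailsAt w (Γ ⇒ Δ) = All (M , w ⊩_) Γ × All (λ F → ¬ M , w ⊩ F) Δ

  Fails : W M → LNS → Set
  Fails w [ c ]    = FailsAt w c
  Fails w (c ∷↗ S) = FailsAt w c × ∃[ v ] R M w v × Fails v S

  FailsAt-≈ : ∀ {w c c'} → c ≈C c' → FailsAt w c' → FailsAt w c
  FailsAt-≈ (perm Γ↭ Δ↭) (Γ✓ , Δ✗) = All-resp-↭ (↭-sym Γ↭) Γ✓ , All-resp-↭ (↭-sym Δ↭) Δ✗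

  Fails-≈ : ∀ {w S S'} → S ≈ S' → Fails w S' → Fails w S
  Fails-≈ (one c≈)    f                  = FailsAt-≈ c≈ f
  Fails-≈ (cons c≈ e) (fc , v , wRv , f) = FailsAt-≈ c≈ fc , v , wRv , Fails-≈ e f

  Fails-EW : ∀ S {w c} → Fails w (toList S ↗ [ c ]) → Fails w S
  Fails-EW [ _ ]    (fc , _)           = fc
  Fails-EW (_ ∷↗ S) (fc , v , wRv , f) = fc , v , wRv , Fails-EW S f

  -- Every rule only touches the last one or two components, so a falsifying path for its
  -- conclusion is cut at the end of 𝒢, repaired there, and glued back.
  focus : ∀ G {w X} → Fails w (G ↗ X) → ∃[ u ] Fails u X × (∀ {X'} → Fails u X' → Fails w (G ↗ X'))
  focus []      f = _ , f , λ f' → f'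
  focus (_ ∷ G) (fc , v , wRv , f) with u , fX , back ← focus G f =
    u , fX , λ f' → fc , v , wRv , back f'

  sound : ∀ {S} → ⊢ S → ∀ w → ¬ Fails w S
  sound (Perm d S≈) w f = sound d w (Fails-≈ S≈ f)
  sound (id {G}) w f with _ , (p✓ ∷ _ , p✗ ∷ _) , _ ← focus G f = p✗ p✓
  sound (⊥L {G}) w f with _ , (b ∷ _ , _) , _ ← focus G f = b
  sound (EW {S} d) w f = sound d w (Fails-EW S f)
  sound (⇛R {G} {B = B} d) w f with u , (Γ✓ , ¬f ∷ Δ✗) , back ← focus G f =
    ¬f λ a → ⊩-stable B u λ ¬b → sound d w (back (a ∷ Γ✓ , ¬f ∷ ¬b ∷ Δ✗))
  sound (⇛L {G} d₁ d₂) w f with _ , (f✓ ∷ Γ✓ , Δ✗) , back ← focus G f =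
    sound d₂ w (back (f✓ ∷ Γ✓ , (λ a → sound d₁ w (back (f✓ ∷ f✓ a ∷ Γ✓ , Δ✗))) ∷ Δ✗))
  sound (□R {G} {A = A} d) w f with u , (Γ✓ , ¬□ ∷ Δ✗) , back ← focus G f =
    ¬□ λ v uRv → ⊩-stable A v λ ¬a → sound d w (back ((Γ✓ , ¬□ ∷ Δ✗) , v , uRv , [] , ¬a ∷ []))
  sound (□L¹ {G} d) w f with _ , ((□✓ ∷ Γ✓ , Δ✗) , v , uRv , Σ✓ , Π✗) , back ← focus G f =
    sound d w (back ((□✓ ∷ Γ✓ , Δ✗) , v , uRv , □✓ v uRv ∷ Σ✓ , Π✗))
  sound (□L² {G} d) w f with u , ((Γ✓ , Δ✗) , v , uRv , □✓ ∷ _ , _) , back ← focus G f =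
    sound d w (back (□✓ u (SymModel.sym M uRv) ∷ Γ✓ , Δ✗))

soundness : ∀ φ → ⊢ [ [] ⇒ φ ∷ [] ] → KB φ
soundness φ d M w = ⊩-stable φ w λ ¬φ → sound d w ([] , ¬φ ∷ [])
  where open Soundness M

-- Hintikka trees

record Saturated (Γ Δ : List Fml) : Set where
  field
    ⊥-free   : ⊥ᶠ ∉ Γ
    disjoint : ∀ {p} → atom p ∈ Γ → atom p ∉ Δ
    ⇛-left   : ∀ {A B} → (A ⇛ B) ∈ Γ → B ∈ Γ ⊎ A ∈ Δ
    ⇛-right  : ∀ {A B} → (A ⇛ B) ∈ Δ → A ∈ Γ × B ∈ Δ

data Clash (Δ : List Fml) : Fml → Set where
  clash : ∀ {p} → atom p ∈ Δ → Clash Δ (atom p)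

data ⇛L-Pending (Γ Δ : List Fml) : Fml → Set where
  pending : ∀ {A B} → B ∉ Γ → A ∉ Δ → ⇛L-Pending Γ Δ (A ⇛ B)

data ⇛R-Pending (Γ Δ : List Fml) : Fml → Set where
  pending : ∀ {A B} → A ∉ Γ ⊎ B ∉ Δ → ⇛R-Pending Γ Δ (A ⇛ B)

clash? : ∀ Δ → Decidable (Clash Δ)
clash? Δ (atom p) = map′ clash (λ { (clash m) → m }) (atom p ∈? Δ)
clash? Δ ⊥ᶠ       = no λ ()
clash? Δ (_ ⇛ _)  = no λ ()
clash? Δ (□ _)    = no λ ()

⇛L-pending? : ∀ Γ Δ → Decidable (⇛L-Pending Γ Δ)
⇛L-pending? Γ Δ (A ⇛ B) =
  map′ (λ (B∉ , A∉) → pending B∉ A∉) (λ { (pending B∉ A∉) → B∉ , A∉ }) (¬? (B ∈? Γ) ×-dec ¬? (A ∈? Δ))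
⇛L-pending? Γ Δ (atom _) = no λ ()
⇛L-pending? Γ Δ ⊥ᶠ       = no λ ()
⇛L-pending? Γ Δ (□ _)    = no λ ()

⇛R-pending? : ∀ Γ Δ → Decidable (⇛R-Pending Γ Δ)
⇛R-pending? Γ Δ (A ⇛ B) = map′ pending (λ { (pending n) → n }) (¬? (A ∈? Γ) ⊎-dec ¬? (B ∈? Δ))
⇛R-pending? Γ Δ (atom _) = no λ ()
⇛R-pending? Γ Δ ⊥ᶠ       = no λ ()
⇛R-pending? Γ Δ (□ _)    = no λ ()

data □L²-Pending (Γp : List Fml) : Fml → Set where
  pending : ∀ {A} → A ∉ Γp → □L²-Pending Γp (□ A)

□L²-pending? : ∀ Γp → Decidable (□L²-Pending Γp)
□L²-pending? Γp (□ A)    = map′ pending (λ { (pending n) → n }) (¬? (A ∈? Γp))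
□L²-pending? Γp (atom _) = no λ ()
□L²-pending? Γp ⊥ᶠ       = no λ ()
□L²-pending? Γp (_ ⇛ _)  = no λ ()

∈-stable : ∀ {A : Fml} {Γ} → ¬ A ∉ Γ → A ∈ Γ
∈-stable {A} {Γ} = decidable-stable (A ∈? Γ)

saturated : ∀ {Γ Δ} → ⊥ᶠ ∉ Γ → ¬ Any (Clash Δ) Γ → ¬ Any (⇛L-Pending Γ Δ) Γ → ¬ Any (⇛R-Pending Γ Δ) Δ →
            Saturated Γ Δ
saturated {Γ} {Δ} ⊥∉Γ no-clash no-⇛L no-⇛R = record
  { ⊥-free   = ⊥∉Γ
  ; disjoint = λ p∈Γ p∈Δ → no-clash (lose p∈Γ (clash p∈Δ))
  ; ⇛-left   = ⇛-left
  ; ⇛-right  = λ m → ∈-stable (λ A∉ → no-⇛R (lose m (pending (inj₁ A∉))))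
                   , ∈-stable (λ B∉ → no-⇛R (lose m (pending (inj₂ B∉))))
  }
  where
  ⇛-left : ∀ {A B} → (A ⇛ B) ∈ Γ → B ∈ Γ ⊎ A ∈ Δ
  ⇛-left {A} {B} m with B ∈? Γ | A ∈? Δ
  ... | yes B∈Γ | _       = inj₁ B∈Γ
  ... | no _    | yes A∈Δ = inj₂ A∈Δ
  ... | no B∉Γ  | no A∉Δ  = ⊥-elim (no-⇛L (lose m (pending B∉Γ A∉Δ)))

infix 4 _▷_
_▷_ : List Fml → List Fml → Set
Γ ▷ Γ' = ∀ {A} → □ A ∈ Γ → A ∈ Γ'

data Tree : Set where
  node : List Fml → List Fml → List Tree → Tree

lhsᵀ rhsᵀ : Tree → List Fml
lhsᵀ (node Γ _ _) = Γ
rhsᵀ (node _ Δ _) = Δ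

children : Tree → List Tree
children (node _ _ ts) = ts

-- Symmetry is built in: a node and each child must see each other through their boxes.
data Hintikka : Tree → Set where
  hintikka : ∀ {Γ Δ ts} → Saturated Γ Δ →
             (∀ {t} → t ∈ ts → Hintikka t × Γ ▷ lhsᵀ t × lhsᵀ t ▷ Γ) →
             (∀ {B} → □ B ∈ Δ → ∃[ t ] t ∈ ts × B ∈ rhsᵀ t) →
             Hintikka (node Γ Δ ts)

World : Set
World = Σ[ t ∈ Tree ] Hintikka t

Adjacent : World → World → Set
Adjacent (t , _) (t' , _) = t' ∈ children t ⊎ t ∈ children t'

treeModel : SymModel
treeModel = record
  { W   = World
  ; R   = Adjacent
  ; V   = λ w p → isYes (atom p ∈? lhsᵀ (proj₁ w))
  ; sym = ⊎-swap
  }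

mutual
  truth-lhs : ∀ F (w : World) → F ∈ lhsᵀ (proj₁ w) → treeModel , w ⊩ F
  truth-lhs (atom p) (node Γ _ _ , _) m = fromWitness {a? = atom p ∈? Γ} m
  truth-lhs ⊥ᶠ (_ , hintikka sat _ _) m = Saturated.⊥-free sat m
  truth-lhs (A ⇛ B) w@(_ , hintikka sat _ _) m a with Saturated.⇛-left sat m
  ... | inj₁ B∈Γ = truth-lhs B w B∈Γ
  ... | inj₂ A∈Δ = ⊥-elim (truth-rhs A w A∈Δ a)
  truth-lhs (□ A) (_ , hintikka _ kids _) m v (inj₁ v∈ts) = truth-lhs A v (proj₁ (proj₂ (kids v∈ts)) m)
  truth-lhs (□ A) _ m (_ , hintikka _ kids _) (inj₂ w∈ts) = truth-lhs A _ (proj₂ (proj₂ (kids w∈ts)) m)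

  truth-rhs : ∀ F (w : World) → F ∈ rhsᵀ (proj₁ w) → ¬ treeModel , w ⊩ F
  truth-rhs (atom p) (node Γ _ _ , hintikka sat _ _) m p✓ =
    Saturated.disjoint sat (toWitness {a? = atom p ∈? Γ} p✓) m
  truth-rhs ⊥ᶠ _ _ b = b
  truth-rhs (A ⇛ B) w@(_ , hintikka sat _ _) m f with Saturated.⇛-right sat m
  ... | A∈Γ , B∈Δ = truth-rhs B w B∈Δ (f (truth-lhs A w A∈Γ))
  truth-rhs (□ A) (_ , hintikka _ kids wit) m f with wit m
  ... | t , t∈ts , A∈t = truth-rhs A v A∈t (f v (inj₁ t∈ts))
    where v = t , proj₁ (kids t∈ts)

-- Derivations inside a context of ancestors

≈C-refl : ∀ {c} → c ≈C c
≈C-refl {_ ⇒ _} = perm ↭-refl ↭-refl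

≈-refl : ∀ {S} → S ≈ S
≈-refl {[ _ ]}   = one ≈C-refl
≈-refl {_ ∷↗ _} = cons ≈C-refl ≈-refl

-- The ancestors of the component under focus are kept nearest first.
under : List Comp → LNS → LNS
under []      X = X
under (c ∷ r) X = under r (c ∷↗ X)

↗-++ : ∀ G H X → ((G ++ H) ↗ X) ≡ (G ↗ (H ↗ X))
↗-++ []      H X = refl
↗-++ (c ∷ G) H X = cong (c ∷↗_) (↗-++ G H X)

under-≡ : ∀ r X → under r X ≡ (reverse r ↗ X)
under-≡ []      X = refl
under-≡ (c ∷ r) X = begin
  under r (c ∷↗ X)                ≡⟨ under-≡ r (c ∷↗ X) ⟩
  (reverse r ↗ ((c ∷ []) ↗ X))    ≡⟨ ↗-++ (reverse r) (c ∷ []) X ⟨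
  ((reverse r ++ c ∷ []) ↗ X)     ≡⟨ cong (_↗ X) (unfold-reverse c r) ⟨
  (reverse (c ∷ r) ↗ X)           ∎
  where open ≡-Reasoning

module _ (r : List Comp) {X : LNS} where

  plug : ⊢ (reverse r ↗ X) → ⊢ under r X
  plug = subst ⊢_ (≡.sym (under-≡ r X))

  unplug : ⊢ under r X → ⊢ (reverse r ↗ X)
  unplug = subst ⊢_ (under-≡ r X)

under-≈ : ∀ r {X Y} → X ≈ Y → under r X ≈ under r Y
under-≈ []      X≈Y = X≈Y
under-≈ (_ ∷ r) X≈Y = under-≈ r (cons ≈C-refl X≈Y)

⊢-≈ : ∀ r {X Y} → X ≈ Y → ⊢ under r X → ⊢ under r Y
⊢-≈ r X≈Y d = Perm d (under-≈ r X≈Y)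

⊢-↭ : ∀ r {Γ Γ' Δ Δ'} → Γ ↭ Γ' → Δ ↭ Δ' → ⊢ under r [ Γ ⇒ Δ ] → ⊢ under r [ Γ' ⇒ Δ' ]
⊢-↭ r Γ↭ Δ↭ = ⊢-≈ r (one (perm Γ↭ Δ↭))

↭-front : ∀ {F : Fml} {Γ} → F ∈ Γ → ∃[ Γ' ] Γ ↭ F ∷ Γ'
↭-front {F} m with ys , zs , refl ← ∈-∃++ m = ys ++ zs , shift F ys zs

⊢-⊥ : ∀ r {Γ Δ} → ⊥ᶠ ∈ Γ → ⊢ under r [ Γ ⇒ Δ ]
⊢-⊥ r ⊥∈Γ with _ , Γ↭ ← ↭-front ⊥∈Γ = ⊢-↭ r (↭-sym Γ↭) ↭-refl (plug r ⊥L)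

⊢-clash : ∀ r {Γ Δ} → Any (Clash Δ) Γ → ⊢ under r [ Γ ⇒ Δ ]
⊢-clash r cl with find cl
... | _ , p∈Γ , clash p∈Δ with _ , Γ↭ ← ↭-front p∈Γ | _ , Δ↭ ← ↭-front p∈Δ = ⊢-↭ r (↭-sym Γ↭) (↭-sym Δ↭) (plug r id)

⊢-⇛L : ∀ r {Γ Δ A B} → (A ⇛ B) ∈ Γ → ⊢ under r [ B ∷ Γ ⇒ Δ ] → ⊢ under r [ Γ ⇒ A ∷ Δ ] →
       ⊢ under r [ Γ ⇒ Δ ]
⊢-⇛L r {A = A} {B} m d₁ d₂ with _ , Γ↭ ← ↭-front m =
  ⊢-↭ r (↭-sym Γ↭) ↭-refl (plug r (⇛L (unplug r (⊢-↭ r B∷Γ↭ ↭-refl d₁)) (unplug r (⊢-↭ r Γ↭ ↭-refl d₂))))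
  where B∷Γ↭ = ↭-trans (prep B Γ↭) (swap B (A ⇛ B) ↭-refl)

⊢-⇛R : ∀ r {Γ Δ A B} → (A ⇛ B) ∈ Δ → ⊢ under r [ A ∷ Γ ⇒ B ∷ Δ ] → ⊢ under r [ Γ ⇒ Δ ]
⊢-⇛R r {A = A} {B} m d with _ , Δ↭ ← ↭-front m =
  ⊢-↭ r ↭-refl (↭-sym Δ↭) (plug r (⇛R (unplug r (⊢-↭ r ↭-refl B∷Δ↭ d))))
  where B∷Δ↭ = ↭-trans (prep B Δ↭) (swap B (A ⇛ B) ↭-refl)

⊢-□L¹ : ∀ r {Γ Δ Σ Π A} → □ A ∈ Γ → ⊢ under r ((Γ ⇒ Δ) ∷↗ [ A ∷ Σ ⇒ Π ]) →
        ⊢ under r ((Γ ⇒ Δ) ∷↗ [ Σ ⇒ Π ])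
⊢-□L¹ r m d with _ , Γ↭ ← ↭-front m =
  ⊢-≈ r (cons (perm (↭-sym Γ↭) ↭-refl) ≈-refl) (plug r (□L¹ (unplug r (⊢-≈ r (cons (perm Γ↭ ↭-refl) ≈-refl) d))))

⊢-□L¹⋆ : ∀ r {Γ Δ Π} Σ → (∀ {A} → A ∈ Σ → □ A ∈ Γ) → ⊢ under r ((Γ ⇒ Δ) ∷↗ [ Σ ⇒ Π ]) →
         ⊢ under r ((Γ ⇒ Δ) ∷↗ [ [] ⇒ Π ])
⊢-□L¹⋆ r []      _     d = d
⊢-□L¹⋆ r (_ ∷ Σ) □Σ⊆Γ d = ⊢-□L¹⋆ r Σ (□Σ⊆Γ ∘ there) (⊢-□L¹ r (□Σ⊆Γ (here refl)) d)

⊢-□L² : ∀ r {Γ Δ Σ Π A} → □ A ∈ Σ → ⊢ under r [ A ∷ Γ ⇒ Δ ] → ⊢ under ((Γ ⇒ Δ) ∷ r) [ Σ ⇒ Π ]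
⊢-□L² r m d with _ , Σ↭ ← ↭-front m = ⊢-↭ (_ ∷ r) (↭-sym Σ↭) ↭-refl (plug r (□L² (unplug r d)))

⊢-□R : ∀ r {Γ Δ B} → □ B ∈ Δ → ⊢ under ((Γ ⇒ Δ) ∷ r) [ unbox Γ ⇒ B ∷ [] ] → ⊢ under r [ Γ ⇒ Δ ]
⊢-□R r {Γ} m d with _ , Δ↭ ← ↭-front m =
  ⊢-↭ r ↭-refl (↭-sym Δ↭) (plug r (□R (unplug r (⊢-≈ r (cons (perm ↭-refl Δ↭) ≈-refl) unboxed))))
  where unboxed = ⊢-□L¹⋆ r (unbox Γ) (∈-unbox⁻ Γ) d

-- Termination measure

missing : List Fml → List Fml → ℕ
missing X []       = 0
missing X (F ∷ Ys) with F ∈? X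
... | yes _ = missing X Ys
... | no  _ = suc (missing X Ys)

missing≤length : ∀ X Ys → missing X Ys ≤ length Ys
missing≤length X []       = z≤n
missing≤length X (F ∷ Ys) with F ∈? X
... | yes _ = ≤-trans (missing≤length X Ys) (n≤1+n _)
... | no  _ = s≤s (missing≤length X Ys)

missing-antitone : ∀ {X Y} → X ⊆ Y → ∀ Ys → missing Y Ys ≤ missing X Ys
missing-antitone X⊆Y []       = z≤n
missing-antitone {X} {Y} X⊆Y (F ∷ Ys) with F ∈? X | F ∈? Y
... | yes _   | yes _  = missing-antitone X⊆Y Ys
... | yes F∈X | no F∉Y = ⊥-elim (F∉Y (X⊆Y F∈X))
... | no _    | yes _  = ≤-trans (missing-antitone X⊆Y Ys) (n≤1+n _)
... | no _    | no _   = s≤s (missing-antitone X⊆Y Ys)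

missing-< : ∀ {X Y F} → X ⊆ Y → F ∈ Y → F ∉ X → ∀ Ys → F ∈ Ys → missing Y Ys < missing X Ys
missing-< {X} {Y} X⊆Y F∈Y F∉X (G ∷ Ys) (here refl) with G ∈? X | G ∈? Y
... | yes G∈X | _      = ⊥-elim (F∉X G∈X)
... | no _    | yes _  = s≤s (missing-antitone X⊆Y Ys)
... | no _    | no G∉Y = ⊥-elim (G∉Y F∈Y)
missing-< {X} {Y} X⊆Y F∈Y F∉X (G ∷ Ys) (there F∈Ys) with G ∈? X | G ∈? Y
... | yes G∈X | no G∉Y = ⊥-elim (G∉Y (X⊆Y G∈X))
... | yes _   | yes _  = missing-< X⊆Y F∈Y F∉X Ys F∈Ys
... | no _    | yes _  = s≤s (missing-antitone X⊆Y Ys)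
... | no _    | no _   = s≤s (missing-< X⊆Y F∈Y F∉X Ys F∈Ys)

infix 4 _<ₗ_
_<ₗ_ : ∀ {n} → Vec ℕ n → Vec ℕ n → Set
_<ₗ_ = Lex-< _≡_ _<_

<ₗ-wellFounded : ∀ {n} → WellFounded (_<ₗ_ {n})
<ₗ-wellFounded = Lex-wellFounded ≡.trans (λ {x} → subst (x <_)) <-wellFounded

pad : ℕ → (n : ℕ) → List ℕ → Vec ℕ n
pad k zero    _        = []
pad k (suc n) []       = k ∷ pad k n []
pad k (suc n) (x ∷ xs) = x ∷ pad k n xs

headOr : ℕ → List ℕ → ℕ
headOr k []      = k
headOr k (x ∷ _) = x

pad-< : ∀ k {n} pre {y} tl → length pre < n → y < headOr k tl →
        pad k n (pre ++ y ∷ []) <ₗ pad k n (pre ++ tl)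
pad-< k {suc n} []        []      _       y<k = this y<k refl
pad-< k {suc n} []        (_ ∷ _) _       y<x = this y<x refl
pad-< k {suc n} (_ ∷ pre) tl      (s≤s l) y<  = next refl (pad-< k pre tl l y<)

-- Completeness

module Completeness (φ : Fml) where

  top : ℕ
  top = modalDepth φ

  Φ : List Fml
  Φ = subformulas φ

  Relevant : ℕ → Fml → Set
  Relevant d F = F ≼ φ × modalDepth F ≤ d

  relevant-weaken : ∀ {d F} → Relevant d F → Relevant (suc d) F
  relevant-weaken (F≼φ , F≤d) = F≼φ , ≤-trans F≤d (n≤1+n _)

  relevant-⇛ˡ : ∀ {d A B} → Relevant d (A ⇛ B) → Relevant d A
  relevant-⇛ˡ {A = A} {B} (≼φ , ≤d) =
    ≼-trans (there (∈-++⁺ˡ (≼-refl A))) ≼φ , ≤-trans (m≤m⊔n (modalDepth A) (modalDepth B)) ≤d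

  relevant-⇛ʳ : ∀ {d A B} → Relevant d (A ⇛ B) → Relevant d B
  relevant-⇛ʳ {A = A} {B} (≼φ , ≤d) =
    ≼-trans (there (∈-++⁺ʳ (subformulas A) (≼-refl B))) ≼φ , ≤-trans (m≤n⊔m (modalDepth A) (modalDepth B)) ≤d

  relevant-□ : ∀ {d A} → Relevant (suc d) (□ A) → Relevant d A
  relevant-□ {A = A} (≼φ , s≤s ≤d) = ≼-trans (there (≼-refl A)) ≼φ , ≤d

  RelevantComp : ℕ → Comp → Set
  RelevantComp d (Γ ⇒ Δ) = All (Relevant d) Γ × All (Relevant d) Δ

  -- The index bounds the modal depth in the focused component; it drops by one per nesting level.
  data Stack : ℕ → List Comp → Set where
    root : Stack top []
    push : ∀ {d p r} → RelevantComp (suc d) p → Stack (suc d) r → Stack d (p ∷ r)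

  Stack-length : ∀ {d r} → Stack d r → length r + d ≡ top
  Stack-length root                  = refl
  Stack-length (push {d} {r = r} _ st) = ≡.trans (≡.sym (+-suc (length r) d)) (Stack-length st)

  room : Comp → ℕ
  room (Γ ⇒ Δ) = missing Γ Φ + missing Δ Φ

  roomBound : ℕ
  roomBound = suc (length Φ + length Φ)

  room<roomBound : ∀ c → room c < roomBound
  room<roomBound (Γ ⇒ Δ) = s≤s (+-mono-≤ (missing≤length Γ Φ) (missing≤length Δ Φ))

  room-∷ˡ : ∀ {F Γ Δ} → F ≼ φ → F ∉ Γ → room (F ∷ Γ ⇒ Δ) < room (Γ ⇒ Δ)
  room-∷ˡ {Δ = Δ} F≼φ F∉Γ =
    +-mono-<-≤ (missing-< there (here refl) F∉Γ Φ F≼φ) (≤-refl {missing Δ Φ})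

  room-∷ʳ : ∀ {F Γ Δ} → F ≼ φ → F ∉ Δ → room (Γ ⇒ F ∷ Δ) < room (Γ ⇒ Δ)
  room-∷ʳ {Γ = Γ} F≼φ F∉Δ =
    +-mono-≤-< (≤-refl {missing Γ Φ}) (missing-< there (here refl) F∉Δ Φ F≼φ)

  room-∷² : ∀ {A B Γ Δ} → A ≼ φ → B ≼ φ → A ∉ Γ ⊎ B ∉ Δ → room (A ∷ Γ ⇒ B ∷ Δ) < room (Γ ⇒ Δ)
  room-∷² {A} {B} {Γ} {Δ} A≼φ _ (inj₁ A∉Γ) =
    +-mono-<-≤ (missing-< there (here refl) A∉Γ Φ A≼φ) (missing-antitone {Δ} {B ∷ Δ} there Φ)
  room-∷² {A} {B} {Γ} {Δ} _ B≼φ (inj₂ B∉Δ) =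
    +-mono-≤-< (missing-antitone {Γ} {A ∷ Γ} there Φ) (missing-< there (here refl) B∉Δ Φ B≼φ)

  trail : List Comp → List ℕ
  trail []      = []
  trail (p ∷ r) = trail r ++ room p ∷ []

  length-trail : ∀ r → length (trail r) ≡ length r
  length-trail []      = refl
  length-trail (p ∷ r) = ≡.trans (length-++ (trail r)) (≡.trans (+-comm _ 1) (cong suc (length-trail r)))

  trail-fits : ∀ {d r} → Stack d r → length (trail r) < suc top
  trail-fits {d} {r} st rewrite length-trail r = s≤s (subst (length r ≤_) (Stack-length st) (m≤m+n (length r) d))

  -- Each search step lowers the profile lexicographically: saturating lowers the room of the focus,
  -- opening a child fills a padding slot, and □L² lowers the room of the parent.
  profile : List Comp → Comp → Vec ℕ (suc top)
  profile r c = pad roomBound (suc top) (trail r ++ room c ∷ [])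

  profile-step : ∀ {d r c c'} → Stack d r → room c' < room c → profile r c' <ₗ profile r c
  profile-step {r = r} {c} st lt = pad-< roomBound (trail r) (room c ∷ []) (trail-fits st) lt

  profile-child : ∀ {d r c e} → Stack d (c ∷ r) → profile (c ∷ r) e <ₗ profile r c
  profile-child {r = r} {c} {e} st =
    subst (λ xs → profile (c ∷ r) e <ₗ pad roomBound (suc top) xs) (++-identityʳ (trail (c ∷ r)))
      (pad-< roomBound (trail (c ∷ r)) [] (trail-fits st) (room<roomBound e))

  profile-parent : ∀ {d r p p' c} → Stack d r → room p' < room p → profile r p' <ₗ profile (p ∷ r) c
  profile-parent {r = r} {p} {p'} {c} st lt =
    subst (λ xs → profile r p' <ₗ pad roomBound (suc top) xs) (≡.sym (++-assoc (trail r) (room p ∷ []) (room c ∷ [])))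
      (pad-< roomBound (trail r) (room p ∷ room c ∷ []) (trail-fits st) lt)

  UpTo : List Fml → List Comp → Set
  UpTo Γ []             = ⊤
  UpTo Γ ((Γp ⇒ _) ∷ _) = Γ ▷ Γp

  HintikkaFor : Comp → List Comp → Set
  HintikkaFor (Γ ⇒ Δ) r = Σ[ T ∈ Tree ] Hintikka T × Γ ⊆ lhsᵀ T × Δ ⊆ rhsᵀ T × UpTo (lhsᵀ T) r

  Open : Comp → List Comp → Set
  Open c []      = HintikkaFor c []
  Open c (p ∷ r) = HintikkaFor c (p ∷ r) ⊎ Open p r

  open-here : ∀ {c} r → HintikkaFor c r → Open c r
  open-here []      h = h
  open-here (_ ∷ _) h = inj₁ h

  HintikkaFor-⊆ : ∀ {Γ Γ' Δ Δ' r} → Γ ⊆ Γ' → Δ ⊆ Δ' → HintikkaFor (Γ' ⇒ Δ') r → HintikkaFor (Γ ⇒ Δ) r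
  HintikkaFor-⊆ Γ⊆ Δ⊆ (T , hT , Γ'⊆ , Δ'⊆ , up) = T , hT , (λ m → Γ'⊆ (Γ⊆ m)) , (λ m → Δ'⊆ (Δ⊆ m)) , up

  Open-⊆ : ∀ {Γ Γ' Δ Δ'} r → Γ ⊆ Γ' → Δ ⊆ Δ' → Open (Γ' ⇒ Δ') r → Open (Γ ⇒ Δ) r
  Open-⊆ []      Γ⊆ Δ⊆ h        = HintikkaFor-⊆ Γ⊆ Δ⊆ h
  Open-⊆ (_ ∷ _) Γ⊆ Δ⊆ (inj₁ h) = inj₁ (HintikkaFor-⊆ Γ⊆ Δ⊆ h)
  Open-⊆ (_ ∷ _) Γ⊆ Δ⊆ (inj₂ o) = inj₂ o

  Result : Comp → List Comp → Set
  Result c r = ⊢ under r [ c ] ⊎ Open c r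

  SearchBelow : List Comp → Comp → Set
  SearchBelow r c = ∀ {d'} r' c' → RelevantComp d' c' → Stack d' r' → profile r' c' <ₗ profile r c → Result c' r'

  spawn : ∀ {d r Γ Δ B} → RelevantComp d (Γ ⇒ Δ) → Stack d r → SearchBelow r (Γ ⇒ Δ) → □ B ∈ Δ →
          Result (unbox Γ ⇒ B ∷ []) ((Γ ⇒ Δ) ∷ r)
  spawn {r = r} {Γ} {Δ} {B} rc@(rΓ , rΔ) st ih □B∈Δ with All.lookup rΔ □B∈Δ
  ... | rel@(_ , s≤s _) = ih ((Γ ⇒ Δ) ∷ r) (unbox Γ ⇒ B ∷ []) rc' (push rc st) (profile-child (push rc st))
    where rc' = All.tabulate (λ m → relevant-□ (All.lookup rΓ (∈-unbox⁻ Γ m))) , relevant-□ rel ∷ []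

  module Step {d r Γ Δ} (rc : RelevantComp d (Γ ⇒ Δ)) (st : Stack d r) (ih : SearchBelow r (Γ ⇒ Δ)) where

    continue : ∀ c' → RelevantComp d c' → room c' < room (Γ ⇒ Δ) → Result c' r
    continue c' rc' lt = ih r c' rc' st (profile-step {c = Γ ⇒ Δ} {c'} st lt)

    branch-⇛L : ∃[ F ] F ∈ Γ × ⇛L-Pending Γ Δ F → Result (Γ ⇒ Δ) r
    branch-⇛L (_ , m , pending {A} {B} B∉Γ A∉Δ) = combine
      (continue (B ∷ Γ ⇒ Δ) (relB ∷ proj₁ rc , proj₂ rc) (room-∷ˡ (proj₁ relB) B∉Γ))
      (continue (Γ ⇒ A ∷ Δ) (proj₁ rc , relA ∷ proj₂ rc) (room-∷ʳ (proj₁ relA) A∉Δ))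
      where
      relA = relevant-⇛ˡ (All.lookup (proj₁ rc) m)
      relB = relevant-⇛ʳ (All.lookup (proj₁ rc) m)
      combine : Result (B ∷ Γ ⇒ Δ) r → Result (Γ ⇒ A ∷ Δ) r → Result (Γ ⇒ Δ) r
      combine (inj₁ d₁) (inj₁ d₂) = inj₁ (⊢-⇛L r m d₁ d₂)
      combine (inj₂ o)  _         = inj₂ (Open-⊆ r there (λ n → n) o)
      combine (inj₁ _)  (inj₂ o)  = inj₂ (Open-⊆ r (λ n → n) there o)

    expand-⇛R : ∃[ F ] F ∈ Δ × ⇛R-Pending Γ Δ F → Result (Γ ⇒ Δ) r
    expand-⇛R (_ , m , pending {A} {B} new) =
      ⊎-map (⊢-⇛R r m) (Open-⊆ r there there)
        (continue (A ∷ Γ ⇒ B ∷ Δ) (relA ∷ proj₁ rc , relB ∷ proj₂ rc) (room-∷² (proj₁ relA) (proj₁ relB) new))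
      where
      relA = relevant-⇛ˡ (All.lookup (proj₂ rc) m)
      relB = relevant-⇛ʳ (All.lookup (proj₂ rc) m)

    Children : List Fml → Set
    Children Fs = Σ[ ts ∈ List Tree ] (∀ {t} → t ∈ ts → Hintikka t × Γ ▷ lhsᵀ t × lhsᵀ t ▷ Γ)
                                    × (∀ {B} → □ B ∈ Fs → ∃[ t ] t ∈ ts × B ∈ rhsᵀ t)

    skip : ∀ {F Fs} → (∀ {B} → □ B ≢ F) → Children Fs → Children (F ∷ Fs)
    skip not-□ (ts , ok , wit) = ts , ok , λ { (here eq) → ⊥-elim (not-□ eq) ; (there m) → wit m }

    add-child : ∀ F {Fs} → F ∈ Δ → Children Fs → Result (Γ ⇒ Δ) r ⊎ Children (F ∷ Fs)
    add-child (atom _) _ = inj₂ ∘ skip λ ()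
    add-child ⊥ᶠ       _ = inj₂ ∘ skip λ ()
    add-child (_ ⇛ _)  _ = inj₂ ∘ skip λ ()
    add-child (□ B) {Fs} □B∈Δ (ts , ok , wit) with spawn rc st ih □B∈Δ
    ... | inj₁ der        = inj₁ (inj₁ (⊢-□R r □B∈Δ der))
    ... | inj₂ (inj₂ o)   = inj₁ (inj₂ o)
    ... | inj₂ (inj₁ (T , hT , unbox⊆ , B∈T , T▷Γ)) = inj₂ (T ∷ ts , ok' , wit')
      where
      ok' : ∀ {t} → t ∈ T ∷ ts → Hintikka t × Γ ▷ lhsᵀ t × lhsᵀ t ▷ Γ
      ok' (here refl) = hT , (λ m → unbox⊆ (∈-unbox⁺ Γ m)) , T▷Γ
      ok' (there m)   = ok m
      wit' : ∀ {C} → □ C ∈ □ B ∷ Fs → ∃[ t ] t ∈ T ∷ ts × C ∈ rhsᵀ t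
      wit' (here refl) = T , here refl , B∈T (here refl)
      wit' (there m) with t , t∈ts , C∈t ← wit m = t , there t∈ts , C∈t

    children-for : ∀ Fs → Fs ⊆ Δ → Result (Γ ⇒ Δ) r ⊎ Children Fs
    children-for []       _    = inj₂ ([] , (λ ()) , λ ())
    children-for (F ∷ Fs) Fs⊆Δ with children-for Fs (λ m → Fs⊆Δ (there m))
    ... | inj₁ res = inj₁ res
    ... | inj₂ ch  = add-child F (Fs⊆Δ (here refl)) ch

    close : Saturated Γ Δ → UpTo Γ r → Result (Γ ⇒ Δ) r
    close sat up with children-for Δ (λ m → m)
    ... | inj₁ res               = res
    ... | inj₂ (ts , ok , wit) =
      inj₂ (open-here r (node Γ Δ ts , hintikka sat ok wit , (λ m → m) , (λ m → m) , up))

  propagate : ∀ {d Γp Δp r Γ Δ A} → RelevantComp d (Γ ⇒ Δ) → RelevantComp (suc d) (Γp ⇒ Δp) → Stack (suc d) r →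
              SearchBelow ((Γp ⇒ Δp) ∷ r) (Γ ⇒ Δ) → □ A ∈ Γ → A ∉ Γp → Result (Γ ⇒ Δ) ((Γp ⇒ Δp) ∷ r)
  propagate {Γp = Γp} {Δp} {r} {A = A} rc (rΓp , rΔp) st ih □A∈Γ A∉Γp =
    ⊎-map (⊢-□L² r □A∈Γ) (inj₂ ∘ Open-⊆ r there (λ n → n))
      (ih r (A ∷ Γp ⇒ Δp) (relA ∷ rΓp , rΔp) st (profile-parent st (room-∷ˡ (proj₁ relA) A∉Γp)))
    where relA = relevant-□ (relevant-weaken (relevant-weaken (All.lookup (proj₁ rc) □A∈Γ)))

  saturated-step : ∀ {d r Γ Δ} → RelevantComp d (Γ ⇒ Δ) → Stack d r → SearchBelow r (Γ ⇒ Δ) → Saturated Γ Δ →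
                   Result (Γ ⇒ Δ) r
  saturated-step rc root ih sat = Step.close rc root ih sat tt
  saturated-step {Γ = Γ} rc (push {p = Γp ⇒ Δp} rp st) ih sat with any? (□L²-pending? Γp) Γ
  ... | yes some with _ , □A∈Γ , pending A∉Γp ← find some = propagate rc rp st ih □A∈Γ A∉Γp
  ... | no none = Step.close rc (push rp st) ih sat λ m → ∈-stable λ A∉Γp → none (lose m (pending A∉Γp))

  step : ∀ {d r} c → RelevantComp d c → Stack d r → SearchBelow r c → Result c r
  step {r = r} (Γ ⇒ Δ) rc st ih
    with ⊥ᶠ ∈? Γ | any? (clash? Δ) Γ | any? (⇛L-pending? Γ Δ) Γ | any? (⇛R-pending? Γ Δ) Δ
  ... | yes ⊥∈Γ | _      | _     | _     = inj₁ (⊢-⊥ r ⊥∈Γ)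
  ... | no _    | yes cl | _     | _     = inj₁ (⊢-clash r cl)
  ... | no _    | no _   | yes l | _     = Step.branch-⇛L rc st ih (find l)
  ... | no _    | no _   | no _  | yes ρ = Step.expand-⇛R rc st ih (find ρ)
  ... | no ⊥∉Γ  | no ncl | no nl | no nρ = saturated-step rc st ih (saturated ⊥∉Γ ncl nl nρ)

  search : ∀ {d} r c → RelevantComp d c → Stack d r → Acc _<ₗ_ (profile r c) → Result c r
  search r c rc st (acc rs) = step c rc st λ r' c' rc' st' lt → search r' c' rc' st' (rs lt)

  completeness : KB φ → ⊢ [ [] ⇒ φ ∷ [] ]
  completeness φ∈KB with search [] ([] ⇒ φ ∷ []) ([] , (≼-refl φ , ≤-refl) ∷ []) root (<ₗ-wellFounded _)
  ... | inj₁ der                   = der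
  ... | inj₂ (T , hT , _ , φ∈T , _) =
    ⊥-elim (truth-rhs φ (T , hT) (φ∈T (here refl)) (φ∈KB treeModel (T , hT)))

theorem22 : (φ : Fml) → (⊢ [ [] ⇒ φ ∷ [] ]) ⇔ KB φ
theorem22 φ = mk⇔ (soundness φ) (Completeness.completeness φ)
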